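{- Let $\mathbf{x}$ be a reversal-closed sequence. For all $n\ge 0$, \[ \tfrac{1}{2} \rho_{\mathbf{x}}(n) \leq r_{\mathbf{x}}(n) \leq \tfrac{1}{2} \rho_{\mathbf{x}}(n+1) + 1. \]
   Context: A factor of a sequence is a finite contiguous block. For $u=u(1)\cdots u(m)$, $u^R=u(m)\cdots u(1)$. $\mathbf{x}$ is reversal-closed if $w^R$ is a factor for every factor $w$. $\rho_{\mathbf{x}}(n)$ is the number of distinct length-$n$ factors; $r_{\mathbf{x}}(n)$ the number of distinct length-$n$ factors up to $u\sim v\iff v\in\{u,u^R\}$. -}

module Defs where

open import Data.Nat using (ℕ; _+_)
open import Data.Fin using (Fin; toℕ)
open import Data.Vec using (Vec; lookup; reverse)
open import Data.Product using (Σ; ∃; _×_)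
open import Data.Sum using (_⊎_)
open import Relation.Binary.PropositionalEquality using (_≡_)

Seq : Set → Set
Seq A = ℕ → A

IsFactor : {A : Set} → Seq A → (n : ℕ) → Vec A n → Set
IsFactor x n w = ∃ λ i → (j : Fin n) → lookup w j ≡ x (i + toℕ j)

ReversalClosed : {A : Set} → Seq A → Set
ReversalClosed {A} x = (n : ℕ) (w : Vec A n) → IsFactor x n w → IsFactor x n (reverse w)

-- "The set {w | P w} has exactly m classes w.r.t. the relation _~_":
-- m representatives, pairwise inequivalent, each satisfying P,
-- and every w with P w equivalent to one of them.
HasCardUpTo : {B : Set} → (B → B → Set) → (B → Set) → ℕ → Set
HasCardUpTo {B} _~_ P m =
  Σ (Fin m → B) λ f →
    ((i : Fin m) → P (f i)) ×
    ((i j : Fin m) → f i ~ f j → i ≡ j) ×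
    ((w : B) → P w → ∃ λ i → w ~ f i)

RevEquiv : {A : Set} {n : ℕ} → Vec A n → Vec A n → Set
RevEquiv u v = (v ≡ u) ⊎ (v ≡ reverse u)

FactorComplexity : {A : Set} → Seq A → ℕ → ℕ → Set
FactorComplexity x n m = HasCardUpTo _≡_ (IsFactor x n) m

ReversalComplexity : {A : Set} → Seq A → ℕ → ℕ → Set
ReversalComplexity x n m = HasCardUpTo RevEquiv (IsFactor x n) m

{-# OPTIONS --safe #-}
module Submission where

-- Lower bound: a reversal class {w, wᴿ} contains at most two factors.
-- Upper bound: every reversal class j of length-n factors other than the class of the
-- prefix x[0, n) first occurs at some position p + 1 > 0; let Eⱼ = x[p, p + n] be the
-- factor of length n + 1 just before that occurrence.  The 2 (r − 1) factors Eⱼ and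
-- Eⱼᴿ are pairwise distinct: Eⱼ determines j through its suffix, and Eⱼ = Eₖᴿ would put
-- an occurrence of k at the start of Eⱼ and one of j at the start of Eₖ, each strictly
-- before the other.

open import Defs
open import Data.Nat using (ℕ; zero; suc; pred; _+_; _*_; _≤_; _<_; z≤n; s≤s; s<s; ≢-nonZero)
open import Data.Nat.Properties
  using (+-identityʳ; +-suc; +-comm; *-suc; +-monoˡ-≤; <-asym; ≰⇒>; suc-pred; module ≤-Reasoning)
open import Data.Fin using (Fin; toℕ; punchIn; _≟_)
open import Data.Fin.Properties using (injective⇒≤; +↔⊎; punchIn-injective; punchInᵢ≢i)
open import Data.Vec using (Vec; []; _∷_; lookup; reverse; tabulate; tail; init)
open import Data.Vec.Properties
  using (reverse-injective; reverse-reverse; reverse-involutive; init-reverse;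
         lookup∘tabulate; tabulate∘lookup; tabulate-cong)
open import Data.Product using (∃; _×_; _,_; proj₁; proj₂)
open import Data.Sum using (_⊎_; inj₁; inj₂)
open import Function using (_∘_)
open import Function.Bundles using (_↣_; mk↣; Injection)
open import Function.Construct.Composition using (_↣-∘_)
open import Function.Properties.Inverse using (↔⇒↣; ↔-sym)
open import Relation.Nullary using (¬_; yes; no; contradiction)
open import Relation.Unary using (Pred; Decidable)
open import Relation.Binary.PropositionalEquality
  using (_≡_; _≢_; refl; sym; trans; cong; cong₂; subst; module ≡-Reasoning)

minimal-witness : ∀ {p} {P : Pred ℕ p} → Decidable P →
                  ∀ {t} → P t → ∃ λ s → P s × (∀ {r} → r < s → ¬ P r)
minimal-witness P? {t} Pt with P? 0
... | yes P0 = 0 , P0 , λ ()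
minimal-witness P? {zero}  P0 | no ¬P0 = contradiction P0 ¬P0
minimal-witness P? {suc t} Pt | no ¬P0 with s , Ps , minimal ← minimal-witness (P? ∘ suc) Pt =
  suc s , Ps , λ { {zero} _ → ¬P0 ; {suc r} (s<s r<s) → minimal r<s }

+≤-from-⊎↣ : ∀ {a b c} → (Fin a ⊎ Fin b) ↣ Fin c → a + b ≤ c
+≤-from-⊎↣ f = injective⇒≤ (Injection.injective (f ↣-∘ ↔⇒↣ +↔⊎))

≤+-from-↣⊎ : ∀ {a b c} → Fin c ↣ (Fin a ⊎ Fin b) → c ≤ a + b
≤+-from-↣⊎ f = injective⇒≤ (Injection.injective (↔⇒↣ (↔-sym +↔⊎) ↣-∘ f))

2*m≡m+m : ∀ m → 2 * m ≡ m + m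
2*m≡m+m m = cong (m +_) (+-identityʳ m)

↣-enumeration : ∀ {B D : Set} {P : B → Set} {ρ} → HasCardUpTo _≡_ P ρ →
                (e : D → B) → (∀ d → P (e d)) → (∀ {d d′} → e d ≡ e d′ → d ≡ d′) → D ↣ Fin ρ
↣-enumeration {D = D} {ρ = ρ} (enum , _ , _ , cover) e Pe e-injective =
  mk↣ {to = index} (e-injective ∘ same-element)
  where
  index : D → Fin ρ
  index d = proj₁ (cover (e d) (Pe d))
  same-element : ∀ {d d′} → index d ≡ index d′ → e d ≡ e d′
  same-element {d} {d′} i≡i′ =
    trans (proj₂ (cover (e d) (Pe d))) (trans (cong enum i≡i′) (sym (proj₂ (cover (e d′) (Pe d′)))))

module _ {A : Set} where

  reverse-swap : ∀ {k} {u v : Vec A k} → u ≡ reverse v → v ≡ reverse u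
  reverse-swap u≡vᴿ = sym (reverse-reverse (sym u≡vᴿ))

  RevEquiv-sym : ∀ {k} {u v : Vec A k} → RevEquiv u v → RevEquiv v u
  RevEquiv-sym (inj₁ v≡u)  = inj₁ (sym v≡u)
  RevEquiv-sym (inj₂ v≡uᴿ) = inj₂ (reverse-swap v≡uᴿ)

  RevEquiv-trans : ∀ {k} {u v w : Vec A k} → RevEquiv u v → RevEquiv v w → RevEquiv u w
  RevEquiv-trans (inj₁ refl) v~w         = v~w
  RevEquiv-trans (inj₂ refl) (inj₁ refl) = inj₂ refl
  RevEquiv-trans {u = u} (inj₂ refl) (inj₂ refl) = inj₁ (reverse-involutive u)

  card≤2*reversalClasses : ∀ {n ρ r} {P : Vec A n → Set} →
                           HasCardUpTo _≡_ P ρ → HasCardUpTo RevEquiv P r → ρ ≤ 2 * r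
  card≤2*reversalClasses {ρ = ρ} {r} (enum , Penum , enum-injective , _) (rep , _ , _ , cover) =
    subst (ρ ≤_) (sym (2*m≡m+m r)) (≤+-from-↣⊎ (mk↣ {to = classAndOrientation} injective))
    where
    orientation : ∀ {u} → (∃ λ j → RevEquiv u (rep j)) → Fin r ⊎ Fin r
    orientation (j , inj₁ _) = inj₁ j
    orientation (j , inj₂ _) = inj₂ j
    classAndOrientation : Fin ρ → Fin r ⊎ Fin r
    classAndOrientation i = orientation (cover (enum i) (Penum i))
    same : ∀ {u v} (p : ∃ λ j → RevEquiv u (rep j)) (q : ∃ λ j → RevEquiv v (rep j)) →
           orientation p ≡ orientation q → u ≡ v
    same (j , inj₁ u≡) (.j , inj₁ v≡) refl = trans (sym u≡) v≡
    same (j , inj₂ u≡) (.j , inj₂ v≡) refl = reverse-injective (trans (sym u≡) v≡)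
    injective : ∀ {i i′} → classAndOrientation i ≡ classAndOrientation i′ → i ≡ i′
    injective {i} {i′} = enum-injective i i′ ∘ same (cover (enum i) (Penum i)) (cover (enum i′) (Penum i′))

module _ {A : Set} (x : Seq A) where

  factorAt : ℕ → (k : ℕ) → Vec A k
  factorAt t zero    = []
  factorAt t (suc k) = x t ∷ factorAt (suc t) k

  factorAt≡tabulate : ∀ t k → factorAt t k ≡ tabulate (λ j → x (t + toℕ j))
  factorAt≡tabulate t zero    = refl
  factorAt≡tabulate t (suc k) = cong₂ _∷_ (cong x (sym (+-identityʳ t)))
    (trans (factorAt≡tabulate (suc t) k) (tabulate-cong (λ j → cong x (sym (+-suc t (toℕ j))))))

  factorAt-isFactor : ∀ t k → IsFactor x k (factorAt t k)
  factorAt-isFactor t k = t , λ j →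
    trans (cong (λ w → lookup w j) (factorAt≡tabulate t k)) (lookup∘tabulate _ j)

  isFactor⇒≡factorAt : ∀ {k w} (w-factor : IsFactor x k w) → w ≡ factorAt (proj₁ w-factor) k
  isFactor⇒≡factorAt {k} {w} (t , w≡) =
    trans (sym (tabulate∘lookup w)) (trans (tabulate-cong w≡) (sym (factorAt≡tabulate t k)))

  init-factorAt : ∀ t k → init (factorAt t (suc k)) ≡ factorAt t k
  init-factorAt t zero    = refl
  init-factorAt t (suc k) = cong (x t ∷_) (init-factorAt (suc t) k)

  factorAt-reverse : ∀ {a b k} → factorAt a (suc k) ≡ reverse (factorAt b (suc k)) →
                     factorAt a k ≡ reverse (factorAt (suc b) k)
  factorAt-reverse {a} {b} {k} e = trans (sym (init-factorAt a k))
    (trans (cong init e) (init-reverse (factorAt b (suc k))))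

module Occurrences {A : Set} (x : Seq A) {n r : ℕ} (classes : ReversalComplexity x n r) where

  private
    rep : Fin r → Vec A n
    rep = proj₁ classes
    rep-isFactor : ∀ j → IsFactor x n (rep j)
    rep-isFactor = proj₁ (proj₂ classes)
    rep-distinct : ∀ i j → RevEquiv (rep i) (rep j) → i ≡ j
    rep-distinct = proj₁ (proj₂ (proj₂ classes))
    cover : ∀ w → IsFactor x n w → ∃ λ j → RevEquiv w (rep j)
    cover = proj₂ (proj₂ (proj₂ classes))

  classAt : ℕ → Fin r
  classAt t = proj₁ (cover (factorAt x t n) (factorAt-isFactor x t n))

  private
    factorAt~classAt : ∀ t → RevEquiv (factorAt x t n) (rep (classAt t))
    factorAt~classAt t = proj₂ (cover (factorAt x t n) (factorAt-isFactor x t n))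

  classAt-unique : ∀ {t j} → RevEquiv (factorAt x t n) (rep j) → classAt t ≡ j
  classAt-unique {t} {j} t~j =
    rep-distinct (classAt t) j (RevEquiv-trans (RevEquiv-sym (factorAt~classAt t)) t~j)

  classAt-cong : ∀ {s t} → RevEquiv (factorAt x s n) (factorAt x t n) → classAt s ≡ classAt t
  classAt-cong {t = t} s~t = classAt-unique (RevEquiv-trans s~t (factorAt~classAt t))

  classAt-surjective : ∀ j → ∃ λ t → classAt t ≡ j
  classAt-surjective j = proj₁ (rep-isFactor j) , classAt-unique (inj₁ (isFactor⇒≡factorAt x (rep-isFactor j)))

  private
    firstOccurrenceSpec : ∀ j → ∃ λ s → classAt s ≡ j × (∀ {t} → t < s → classAt t ≢ j)
    firstOccurrenceSpec j = minimal-witness (λ t → classAt t ≟ j) (proj₂ (classAt-surjective j))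

  firstOccurrence : Fin r → ℕ
  firstOccurrence j = proj₁ (firstOccurrenceSpec j)

  classAt-firstOccurrence : ∀ j → classAt (firstOccurrence j) ≡ j
  classAt-firstOccurrence j = proj₁ (proj₂ (firstOccurrenceSpec j))

  classAt<firstOccurrence : ∀ {s} j → s < firstOccurrence j → classAt s ≢ j
  classAt<firstOccurrence j = proj₂ (proj₂ (firstOccurrenceSpec j))

  -- The position just before the first occurrence; junk (0) for the class of the prefix.
  entry : Fin r → ℕ
  entry j = pred (firstOccurrence j)

  firstOccurrence≡suc-entry : ∀ {j} → j ≢ classAt 0 → firstOccurrence j ≡ suc (entry j)
  firstOccurrence≡suc-entry {j} j≢c₀ = sym (suc-pred (firstOccurrence j) {{≢-nonZero first≢0}})
    where
    first≢0 : firstOccurrence j ≢ 0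
    first≢0 first≡0 = j≢c₀ (trans (sym (classAt-firstOccurrence j)) (cong classAt first≡0))

  classAt-suc-entry : ∀ {j} → j ≢ classAt 0 → classAt (suc (entry j)) ≡ j
  classAt-suc-entry {j} j≢c₀ =
    subst (λ t → classAt t ≡ j) (firstOccurrence≡suc-entry j≢c₀) (classAt-firstOccurrence j)

  classAt≤entry : ∀ {s j} → j ≢ classAt 0 → s ≤ entry j → classAt s ≢ j
  classAt≤entry {s} {j} j≢c₀ s≤entry =
    classAt<firstOccurrence j (subst (s <_) (sym (firstOccurrence≡suc-entry j≢c₀)) (s≤s s≤entry))

  entryFactor : Fin r → Vec A (suc n)
  entryFactor j = factorAt x (entry j) (suc n)

  entryFactor-injective : ∀ {j j′} → j ≢ classAt 0 → j′ ≢ classAt 0 →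
                          entryFactor j ≡ entryFactor j′ → j ≡ j′
  entryFactor-injective {j} {j′} j≢c₀ j′≢c₀ e = begin
    j                        ≡⟨ classAt-suc-entry j≢c₀ ⟨
    classAt (suc (entry j))  ≡⟨ classAt-cong (inj₁ (cong tail (sym e))) ⟩
    classAt (suc (entry j′)) ≡⟨ classAt-suc-entry j′≢c₀ ⟩
    j′                       ∎
    where open ≡-Reasoning

  entry-later : ∀ {j j′} → j′ ≢ classAt 0 →
                factorAt x (entry j) n ≡ reverse (factorAt x (suc (entry j′)) n) → entry j′ < entry j
  entry-later j′≢c₀ e = ≰⇒> λ entry-j≤ →
    classAt≤entry j′≢c₀ entry-j≤ (trans (sym (classAt-cong (inj₂ e))) (classAt-suc-entry j′≢c₀))

  entryFactor≢reverse : ∀ {j j′} → j ≢ classAt 0 → j′ ≢ classAt 0 →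
                        entryFactor j ≢ reverse (entryFactor j′)
  entryFactor≢reverse j≢c₀ j′≢c₀ e =
    <-asym (entry-later j′≢c₀ (factorAt-reverse x e)) (entry-later j≢c₀ (factorAt-reverse x (reverse-swap e)))

2*reversalClasses≤factorComplexity+2 : ∀ {A : Set} (x : Seq A) → ReversalClosed x → ∀ {n r ρ′} →
                                        ReversalComplexity x n r → FactorComplexity x (suc n) ρ′ →
                                        2 * r ≤ ρ′ + 2
2*reversalClasses≤factorComplexity+2 x closed {r = zero}  _       _       = z≤n
2*reversalClasses≤factorComplexity+2 {A} x closed {n} {suc m} {ρ′} classes factors = begin
  2 * suc m   ≡⟨ *-suc 2 m ⟩
  2 + 2 * m   ≡⟨ +-comm 2 (2 * m) ⟩
  2 * m + 2   ≤⟨ +-monoˡ-≤ 2 twice-newClasses≤ρ′ ⟩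
  ρ′ + 2      ∎
  where
  open ≤-Reasoning
  open Occurrences x classes

  newClass : Fin m → Fin (suc m)
  newClass = punchIn (classAt 0)

  newClass≢c₀ : ∀ k → newClass k ≢ classAt 0
  newClass≢c₀ = punchInᵢ≢i (classAt 0)

  entryFactors : Fin m ⊎ Fin m → Vec A (suc n)
  entryFactors (inj₁ k) = entryFactor (newClass k)
  entryFactors (inj₂ k) = reverse (entryFactor (newClass k))

  entryFactors-isFactor : ∀ d → IsFactor x (suc n) (entryFactors d)
  entryFactors-isFactor (inj₁ k) = factorAt-isFactor x (entry (newClass k)) (suc n)
  entryFactors-isFactor (inj₂ k) = closed (suc n) (entryFactor (newClass k)) (entryFactors-isFactor (inj₁ k))

  entryFactors-injective : ∀ {d d′} → entryFactors d ≡ entryFactors d′ → d ≡ d′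
  entryFactors-injective {inj₁ k} {inj₁ k′} e =
    cong inj₁ (punchIn-injective (classAt 0) k k′ (entryFactor-injective (newClass≢c₀ k) (newClass≢c₀ k′) e))
  entryFactors-injective {inj₂ k} {inj₂ k′} e =
    cong inj₂ (punchIn-injective (classAt 0) k k′
      (entryFactor-injective (newClass≢c₀ k) (newClass≢c₀ k′) (reverse-injective e)))
  entryFactors-injective {inj₁ k} {inj₂ k′} e = contradiction e (entryFactor≢reverse (newClass≢c₀ k) (newClass≢c₀ k′))
  entryFactors-injective {inj₂ k} {inj₁ k′} e =
    contradiction (sym e) (entryFactor≢reverse (newClass≢c₀ k′) (newClass≢c₀ k))

  twice-newClasses≤ρ′ : 2 * m ≤ ρ′
  twice-newClasses≤ρ′ = subst (_≤ ρ′) (sym (2*m≡m+m m))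
    (+≤-from-⊎↣ (↣-enumeration factors entryFactors entryFactors-isFactor entryFactors-injective))

theorem3p13 : {A : Set} (x : Seq A) → ReversalClosed x →
    (n ρn ρn+1 rn : ℕ) →
    FactorComplexity x n ρn → FactorComplexity x (suc n) ρn+1 →
    ReversalComplexity x n rn →
    (ρn ≤ 2 * rn) × (2 * rn ≤ ρn+1 + 2)
theorem3p13 x closed n ρn ρn+1 rn factors factors′ classes =
  card≤2*reversalClasses factors classes , 2*reversalClasses≤factorComplexity+2 x closed classes factors′
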